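{- Let $\lambda$ be a nonzero real number. For every integer $r\ge1$ and every integer $n\ge0$, $$ \sum_{k=0}^{n}(k)_{r,\lambda}=\sum_{j=0}^{r}(-1)^{r-j}j!{r \brace j}_{ -\lambda}\binom{n+j}{j+1}. $$
   Context: For a real parameter $\mu$ the degenerate falling factorials are $(x)_{0,\mu}=1$ and $(x)_{n,\mu}=x(x-\mu)\cdots(x-(n-1)\mu)$ for $n\ge1$; $(x)_n=(x)_{n,1}$ is the usual falling factorial and $\binom{y}{m}=(y)_m/m!$. The degenerate Stirling numbers of the second kind ${n \brace k}_{\mu}$ are defined by $(x)_{n,\mu}=\sum_{k=0}^{n}{n \brace k}_{\mu}(x)_k$ (so ${r\brace j}_{ -\lambda}$ corresponds to $\mu=-\lambda$). -}

module Defs where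

open import Level using (Level)
open import Data.Nat as ℕ using (ℕ; zero; suc; _∸_)
open import Algebra.Bundles using (CommutativeRing)

-- All notions are developed over an arbitrary commutative ring R
-- (the paper works in ℝ).
module _ {c ℓ : Level} (R : CommutativeRing c ℓ) where
  open CommutativeRing R hiding (zero)

  ι : ℕ → Carrier
  ι zero    = 0#
  ι (suc n) = 1# + ι n

  negOnePow : ℕ → Carrier
  negOnePow zero    = 1#
  negOnePow (suc m) = - 1# * negOnePow m

  sumTo : ℕ → (ℕ → Carrier) → Carrier
  sumTo zero    f = f 0
  sumTo (suc n) f = sumTo n f + f (suc n)

  degFall : Carrier → Carrier → ℕ → Carrier
  degFall x μ zero    = 1#
  degFall x μ (suc n) = degFall x μ n * (x - ι n * μ)

  -- degenerate Stirling numbers of the second kind S_μ(n,k), the unique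
  -- coefficients with (x)_{n,μ} = Σ_k S_μ(n,k) (x)_k, given by the recurrence
  -- obtained from (x)_{n+1,μ} = (x)_{n,μ}(x - nμ) and
  -- (x)_k (x - nμ) = (x)_{k+1} + (k - nμ)(x)_k :
  --   S(0,0)=1, S(0,k+1)=0,
  --   S(n+1,0) = (0 - nμ) S(n,0),
  --   S(n+1,k+1) = S(n,k) + (k+1 - nμ) S(n,k+1).
  degStir : Carrier → ℕ → ℕ → Carrier
  degStir μ zero    zero    = 1#
  degStir μ zero    (suc k) = 0#
  degStir μ (suc n) zero    = (0# - ι n * μ) * degStir μ n zero
  degStir μ (suc n) (suc k) = degStir μ n k + (ι (suc k) - ι n * μ) * degStir μ n (suc k)

{-# OPTIONS --safe #-}
module Submission where

open import Defs
open import Level using (Level)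
open import Data.Nat as ℕ using (ℕ; zero; suc; _∸_; _!; z≤n; s≤s)
open import Data.Nat.Properties using (≤-refl; m≤n⇒m≤1+n; n<1+n; m∸n+n≡m; +-suc)
import Data.Nat.Properties as ℕₚ
open import Data.Nat.Combinatorics
  using (_C_; nC1≡n; k>n⇒nCk≡0; nCk+nC[k+1]≡[n+1]C[k+1])
open import Data.Nat.Tactic.RingSolver using (solve-∀)
open import Relation.Nullary using (¬_)
open import Relation.Binary.PropositionalEquality as ≡ using (_≡_)
open import Algebra.Bundles using (CommutativeRing)

-- (x)_{r,λ} = (-1)^r (-x)_{r,-λ}; expanding (-x)_{r,-λ} in falling factorials
-- by the Stirling numbers S_{-λ}(r,j), and using (-x)_j = (-1)^j ⟨x⟩_j, gives
-- (x)_{r,λ} = Σ_j (-1)^{r-j} S_{-λ}(r,j) ⟨x⟩_j with the rising factorial ⟨x⟩_j.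
-- At x = m + 1 one has ⟨m+1⟩_j = j! C(m+j, j), so by Pascal's rule
-- j! C(n+j, j+1) is the sum of ⟨k⟩_j over 1 ≤ k ≤ n; the k = 0 summand on the
-- left vanishes because r ≥ 1.

[1+k]*[1+m]C[1+k]≡[1+m]*mCk : ∀ m k → suc k ℕ.* (suc m C suc k) ≡ suc m ℕ.* (m C k)
[1+k]*[1+m]C[1+k]≡[1+m]*mCk zero    zero    = ≡.refl
[1+k]*[1+m]C[1+k]≡[1+m]*mCk zero    (suc k) = ℕₚ.*-zeroʳ (suc (suc k))
[1+k]*[1+m]C[1+k]≡[1+m]*mCk (suc m) zero    =
  ≡.trans (ℕₚ.*-identityˡ _) (≡.trans (nC1≡n (suc (suc m))) (≡.sym (ℕₚ.*-identityʳ _)))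
[1+k]*[1+m]C[1+k]≡[1+m]*mCk (suc m) (suc k) = begin
  suc (suc k) ℕ.* (suc (suc m) C suc (suc k))
    ≡⟨ ≡.cong (suc (suc k) ℕ.*_) (nCk+nC[k+1]≡[n+1]C[k+1] (suc m) (suc k)) ⟨
  suc (suc k) ℕ.* (X ℕ.+ Y)
    ≡⟨ regroup k X Y ⟩
  X ℕ.+ (suc k ℕ.* X ℕ.+ suc (suc k) ℕ.* Y)
    ≡⟨ ≡.cong₂ (λ a b → X ℕ.+ (a ℕ.+ b)) ([1+k]*[1+m]C[1+k]≡[1+m]*mCk m k)
                                     ([1+k]*[1+m]C[1+k]≡[1+m]*mCk m (suc k)) ⟩
  X ℕ.+ (suc m ℕ.* (m C k) ℕ.+ suc m ℕ.* (m C suc k))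
    ≡⟨ ≡.cong (X ℕ.+_) (ℕₚ.*-distribˡ-+ (suc m) (m C k) (m C suc k)) ⟨
  X ℕ.+ suc m ℕ.* (m C k ℕ.+ m C suc k)
    ≡⟨ ≡.cong (λ a → X ℕ.+ suc m ℕ.* a) (nCk+nC[k+1]≡[n+1]C[k+1] m k) ⟩
  X ℕ.+ suc m ℕ.* X ∎
  where
  open ≡.≡-Reasoning
  X = suc m C suc k
  Y = suc m C suc (suc k)
  regroup : ∀ k x y → suc (suc k) ℕ.* (x ℕ.+ y) ≡ x ℕ.+ (suc k ℕ.* x ℕ.+ suc (suc k) ℕ.* y)
  regroup = solve-∀

[1+k]!*[1+m]C[1+k]≡k!*mCk*[1+m] : ∀ m k →
  suc k ! ℕ.* (suc m C suc k) ≡ k ! ℕ.* (m C k) ℕ.* suc m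
[1+k]!*[1+m]C[1+k]≡k!*mCk*[1+m] m k = begin
  suc k ! ℕ.* (suc m C suc k)         ≡⟨ shuffle (suc k) (k !) (suc m C suc k) ⟩
  k ! ℕ.* (suc k ℕ.* (suc m C suc k)) ≡⟨ ≡.cong (k ! ℕ.*_) ([1+k]*[1+m]C[1+k]≡[1+m]*mCk m k) ⟩
  k ! ℕ.* (suc m ℕ.* (m C k))         ≡⟨ shuffle′ (k !) (suc m) (m C k) ⟩
  k ! ℕ.* (m C k) ℕ.* suc m           ∎
  where
  open ≡.≡-Reasoning
  shuffle : ∀ a b c → a ℕ.* b ℕ.* c ≡ b ℕ.* (a ℕ.* c)
  shuffle = solve-∀
  shuffle′ : ∀ a b c → a ℕ.* (b ℕ.* c) ≡ a ℕ.* c ℕ.* b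
  shuffle′ = solve-∀

module _ {a ℓ : Level} (R : CommutativeRing a ℓ) where
  open CommutativeRing R hiding (zero)
  open import Algebra.Properties.Ring ring
    using (-1*x≈-x; -‿distribʳ-*; -‿+-comm; -‿involutive)
  open import Algebra.Properties.CommutativeSemigroup +-commutativeSemigroup
    using (interchange; x∙yz≈y∙xz)
  open import Algebra.Properties.Semiring.Mult semiring
    using (_×_; ×-homo-+; ×1-homo-*)
  open import Algebra.Solver.Ring.NaturalCoefficients.Default commutativeSemiring
    using (solve; _:=_; _:+_; _:*_)
  open import Relation.Binary.Reasoning.Setoid setoid

  ι≡×1# : ∀ n → ι R n ≡ n × 1#
  ι≡×1# zero    = ≡.refl
  ι≡×1# (suc n) = ≡.cong (1# +_) (ι≡×1# n)

  ι-homo-+ : ∀ m n → ι R (m ℕ.+ n) ≈ ι R m + ι R n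
  ι-homo-+ m n rewrite ι≡×1# (m ℕ.+ n) | ι≡×1# m | ι≡×1# n = ×-homo-+ 1# m n

  ι-homo-* : ∀ m n → ι R (m ℕ.* n) ≈ ι R m * ι R n
  ι-homo-* m n rewrite ι≡×1# (m ℕ.* n) | ι≡×1# m | ι≡×1# n = ×1-homo-* m n

  negOnePow-homo-+ : ∀ m n → negOnePow R (m ℕ.+ n) ≈ negOnePow R m * negOnePow R n
  negOnePow-homo-+ zero    n = sym (*-identityˡ _)
  negOnePow-homo-+ (suc m) n =
    trans (*-congˡ (negOnePow-homo-+ m n)) (sym (*-assoc _ _ _))

  negOnePow*negOnePow≈1# : ∀ n → negOnePow R n * negOnePow R n ≈ 1#
  negOnePow*negOnePow≈1# zero    = *-identityˡ 1#
  negOnePow*negOnePow≈1# (suc n) = begin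
    (- 1# * N) * (- 1# * N) ≈⟨ swap (- 1#) N ⟩
    (- 1# * - 1#) * (N * N) ≈⟨ *-cong -1*-1≈1 (negOnePow*negOnePow≈1# n) ⟩
    1# * 1#                 ≈⟨ *-identityˡ 1# ⟩
    1#                      ∎
    where
    N = negOnePow R n
    swap : ∀ a b → (a * b) * (a * b) ≈ (a * a) * (b * b)
    swap = solve 2 (λ a b → (a :* b) :* (a :* b) := (a :* a) :* (b :* b)) refl
    -1*-1≈1 : - 1# * - 1# ≈ 1#
    -1*-1≈1 = trans (-1*x≈-x (- 1#)) (-‿involutive 1#)

  negOnePow*negOnePow≈negOnePow[∸] : ∀ {m n} → n ℕ.≤ m →
    negOnePow R m * negOnePow R n ≈ negOnePow R (m ∸ n)
  negOnePow*negOnePow≈negOnePow[∸] {m} {n} n≤m = begin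
    negOnePow R m * N n
      ≡⟨ ≡.cong (λ k → negOnePow R k * N n) (m∸n+n≡m n≤m) ⟨
    negOnePow R (m ∸ n ℕ.+ n) * N n
      ≈⟨ *-congʳ (negOnePow-homo-+ (m ∸ n) n) ⟩
    (N (m ∸ n) * N n) * N n
      ≈⟨ *-assoc _ _ _ ⟩
    N (m ∸ n) * (N n * N n)
      ≈⟨ *-congˡ (negOnePow*negOnePow≈1# n) ⟩
    N (m ∸ n) * 1#
      ≈⟨ *-identityʳ _ ⟩
    N (m ∸ n) ∎
    where N = negOnePow R

  sumTo-cong : ∀ n {f g : ℕ → Carrier} → (∀ k → k ℕ.≤ n → f k ≈ g k) →
    sumTo R n f ≈ sumTo R n g
  sumTo-cong zero    f≈g = f≈g 0 z≤n
  sumTo-cong (suc n) f≈g =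
    +-cong (sumTo-cong n (λ k k≤n → f≈g k (m≤n⇒m≤1+n k≤n))) (f≈g (suc n) ≤-refl)

  sumTo≈0# : ∀ n {f : ℕ → Carrier} → (∀ k → k ℕ.≤ n → f k ≈ 0#) → sumTo R n f ≈ 0#
  sumTo≈0# zero    f≈0 = f≈0 0 z≤n
  sumTo≈0# (suc n) f≈0 =
    trans (+-cong (sumTo≈0# n (λ k k≤n → f≈0 k (m≤n⇒m≤1+n k≤n))) (f≈0 (suc n) ≤-refl))
          (+-identityˡ 0#)

  sumTo-+ : ∀ n (f g : ℕ → Carrier) →
    sumTo R n (λ k → f k + g k) ≈ sumTo R n f + sumTo R n g
  sumTo-+ zero    f g = refl
  sumTo-+ (suc n) f g = trans (+-congʳ (sumTo-+ n f g)) (interchange _ _ _ _)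

  *-distribˡ-sumTo : ∀ n a (f : ℕ → Carrier) → a * sumTo R n f ≈ sumTo R n (λ k → a * f k)
  *-distribˡ-sumTo zero    a f = refl
  *-distribˡ-sumTo (suc n) a f = trans (distribˡ _ _ _) (+-congʳ (*-distribˡ-sumTo n a f))

  *-distribʳ-sumTo : ∀ n a (f : ℕ → Carrier) → sumTo R n f * a ≈ sumTo R n (λ k → f k * a)
  *-distribʳ-sumTo zero    a f = refl
  *-distribʳ-sumTo (suc n) a f = trans (distribʳ _ _ _) (+-congʳ (*-distribʳ-sumTo n a f))

  sumTo-suc : ∀ n (f : ℕ → Carrier) → sumTo R (suc n) f ≈ f 0 + sumTo R n (λ k → f (suc k))
  sumTo-suc zero    f = refl
  sumTo-suc (suc n) f = trans (+-congʳ (sumTo-suc n f)) (+-assoc _ _ _)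

  fall rise : Carrier → ℕ → Carrier
  fall x = degFall R x 1#
  rise x = degFall R x (- 1#)

  degFall-cong : ∀ {x y μ ν} n → x ≈ y → μ ≈ ν → degFall R x μ n ≈ degFall R y ν n
  degFall-cong zero    x≈y μ≈ν = refl
  degFall-cong (suc n) x≈y μ≈ν =
    *-cong (degFall-cong n x≈y μ≈ν) (+-cong x≈y (-‿cong (*-congˡ μ≈ν)))

  degFall-neg : ∀ x μ n → degFall R (- x) (- μ) n ≈ negOnePow R n * degFall R x μ n
  degFall-neg x μ zero    = sym (*-identityˡ 1#)
  degFall-neg x μ (suc n) = begin
    degFall R (- x) (- μ) n * (- x - b * - μ) ≈⟨ *-cong (degFall-neg x μ n) negated-factor ⟩
    (N * D) * (- 1# * (x - b * μ))            ≈⟨ regroup N D (- 1#) (x - b * μ) ⟩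
    (- 1# * N) * (D * (x - b * μ))            ∎
    where
    N = negOnePow R n
    D = degFall R x μ n
    b = ι R n
    negated-factor : - x - b * - μ ≈ - 1# * (x - b * μ)
    negated-factor = begin
      - x - b * - μ     ≈⟨ +-congˡ (-‿cong (-‿distribʳ-* b μ)) ⟨
      - x + - - (b * μ) ≈⟨ -‿+-comm x (- (b * μ)) ⟩
      - (x - b * μ)     ≈⟨ -1*x≈-x _ ⟨
      - 1# * (x - b * μ) ∎
    regroup : ∀ a d m y → (a * d) * (m * y) ≈ (m * a) * (d * y)
    regroup = solve 4 (λ a d m y → (a :* d) :* (m :* y) := (m :* a) :* (d :* y)) refl

  fall-neg : ∀ x k → fall (- x) k ≈ negOnePow R k * rise x k
  fall-neg x k = trans (degFall-cong k refl (sym (-‿involutive 1#))) (degFall-neg x (- 1#) k)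

  degFall-0#-suc : ∀ μ n → degFall R 0# μ (suc n) ≈ 0#
  degFall-0#-suc μ zero    = begin
    1# * (0# - 0# * μ) ≈⟨ *-identityˡ _ ⟩
    0# - 0# * μ        ≈⟨ +-congˡ (-‿cong (zeroˡ μ)) ⟩
    0# - 0#            ≈⟨ -‿inverseʳ 0# ⟩
    0#                 ∎
  degFall-0#-suc μ (suc n) = trans (*-congʳ (degFall-0#-suc μ n)) (zeroˡ _)

  degStir-vanishes : ∀ μ {n k} → n ℕ.< k → degStir R μ n k ≈ 0#
  degStir-vanishes μ {zero}  {suc k} _         = refl
  degStir-vanishes μ {suc n} {suc k} (s≤s n<k) = begin
    degStir R μ n k + c * degStir R μ n (suc k)
      ≈⟨ +-cong (degStir-vanishes μ n<k) (*-congˡ (degStir-vanishes μ (m≤n⇒m≤1+n n<k))) ⟩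
    0# + c * 0#  ≈⟨ +-identityˡ _ ⟩
    c * 0#       ≈⟨ zeroʳ c ⟩
    0#           ∎
    where c = ι R (suc k) - ι R n * μ

  x-z≈[x-y]+[y-z] : ∀ x y z → x - z ≈ (x - y) + (y - z)
  x-z≈[x-y]+[y-z] x y z = sym (begin
    (x - y) + (y - z)   ≈⟨ +-assoc x (- y) (y - z) ⟩
    x + (- y + (y - z)) ≈⟨ +-congˡ (+-assoc (- y) y (- z)) ⟨
    x + ((- y + y) - z) ≈⟨ +-congˡ (+-congʳ (-‿inverseˡ y)) ⟩
    x + (0# - z)        ≈⟨ +-congˡ (+-identityˡ (- z)) ⟩
    x - z               ∎)

  degFall≈Σ-degStir*fall : ∀ x μ n →
    degFall R x μ n ≈ sumTo R n (λ k → degStir R μ n k * fall x k)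
  degFall≈Σ-degStir*fall x μ zero    = sym (*-identityˡ 1#)
  degFall≈Σ-degStir*fall x μ (suc n) = begin
    degFall R x μ n * (x - b)
      ≈⟨ *-congʳ (degFall≈Σ-degStir*fall x μ n) ⟩
    sumTo R n (λ k → S k * fall x k) * (x - b)
      ≈⟨ *-distribʳ-sumTo n (x - b) _ ⟩
    sumTo R n (λ k → (S k * fall x k) * (x - b))
      ≈⟨ sumTo-cong n (λ k _ → split k) ⟩
    sumTo R n (λ k → A k + h k)
      ≈⟨ sumTo-+ n A h ⟩
    sumTo R n A + sumTo R n h
      ≈⟨ +-congˡ (trans (+-congˡ top-vanishes) (+-identityʳ _)) ⟨
    sumTo R n A + sumTo R (suc n) h
      ≈⟨ +-congˡ (sumTo-suc n h) ⟩
    sumTo R n A + (h 0 + sumTo R n (λ k → h (suc k)))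
      ≈⟨ x∙yz≈y∙xz _ _ _ ⟩
    h 0 + (sumTo R n A + sumTo R n (λ k → h (suc k)))
      ≈⟨ +-cong bottom (sumTo-+ n A (λ k → h (suc k))) ⟨
    S′ 0 * fall x 0 + sumTo R n (λ k → A k + h (suc k))
      ≈⟨ +-congˡ (sumTo-cong n (λ k _ → recurrence k)) ⟨
    S′ 0 * fall x 0 + sumTo R n (λ k → S′ (suc k) * fall x (suc k))
      ≈⟨ sumTo-suc n (λ k → S′ k * fall x k) ⟨
    sumTo R (suc n) (λ k → S′ k * fall x k) ∎
    where
    S S′ : ℕ → Carrier
    S  = degStir R μ n
    S′ = degStir R μ (suc n)
    b = ι R n * μ
    A h : ℕ → Carrier
    A k = S k * fall x (suc k)
    h k = (ι R k - b) * (S k * fall x k)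
    split : ∀ k → (S k * fall x k) * (x - b) ≈ A k + h k
    split k = begin
      (S k * fall x k) * (x - b)
        ≈⟨ *-congˡ (trans (x-z≈[x-y]+[y-z] x (ι R k) b)
                          (+-congʳ (+-congˡ (-‿cong (sym (*-identityʳ _)))))) ⟩
      (S k * fall x k) * ((x - ι R k * 1#) + (ι R k - b))
        ≈⟨ expand (S k) (fall x k) (x - ι R k * 1#) (ι R k - b) ⟩
      A k + h k ∎
      where
      expand : ∀ s f y z → (s * f) * (y + z) ≈ s * (f * y) + z * (s * f)
      expand = solve 4 (λ s f y z → (s :* f) :* (y :+ z) := s :* (f :* y) :+ z :* (s :* f)) refl
    recurrence : ∀ k → S′ (suc k) * fall x (suc k) ≈ A k + h (suc k)
    recurrence k = trans (distribʳ _ _ _) (+-congˡ (*-assoc _ _ _))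
    bottom : S′ 0 * fall x 0 ≈ h 0
    bottom = *-assoc _ _ _
    top-vanishes : h (suc n) ≈ 0#
    top-vanishes = trans (*-congˡ (trans (*-congʳ (degStir-vanishes μ (n<1+n n))) (zeroˡ _)))
                         (zeroʳ _)

  degFall≈Σ-signed-degStir*rise : ∀ x μ n →
    degFall R x μ n ≈ sumTo R n (λ k → (negOnePow R (n ∸ k) * degStir R (- μ) n k) * rise x k)
  degFall≈Σ-signed-degStir*rise x μ n = begin
    degFall R x μ n
      ≈⟨ trans (*-congʳ (negOnePow*negOnePow≈1# n)) (*-identityˡ _) ⟨
    (N n * N n) * degFall R x μ n
      ≈⟨ *-assoc _ _ _ ⟩
    N n * (N n * degFall R x μ n)
      ≈⟨ *-congˡ (degFall-neg x μ n) ⟨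
    N n * degFall R (- x) (- μ) n
      ≈⟨ *-congˡ (degFall≈Σ-degStir*fall (- x) (- μ) n) ⟩
    N n * sumTo R n (λ k → S k * fall (- x) k)
      ≈⟨ *-distribˡ-sumTo n (N n) _ ⟩
    sumTo R n (λ k → N n * (S k * fall (- x) k))
      ≈⟨ sumTo-cong n signs ⟩
    sumTo R n (λ k → (N (n ∸ k) * S k) * rise x k) ∎
    where
    N S : ℕ → Carrier
    N = negOnePow R
    S = degStir R (- μ) n
    signs : ∀ k → k ℕ.≤ n → N n * (S k * fall (- x) k) ≈ (N (n ∸ k) * S k) * rise x k
    signs k k≤n = begin
      N n * (S k * fall (- x) k)     ≈⟨ *-congˡ (*-congˡ (fall-neg x k)) ⟩
      N n * (S k * (N k * rise x k)) ≈⟨ regroup (N n) (S k) (N k) (rise x k) ⟩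
      ((N n * N k) * S k) * rise x k ≈⟨ *-congʳ (*-congʳ (negOnePow*negOnePow≈negOnePow[∸] k≤n)) ⟩
      (N (n ∸ k) * S k) * rise x k   ∎
      where
      regroup : ∀ a s b y → a * (s * (b * y)) ≈ ((a * b) * s) * y
      regroup = solve 4 (λ a s b y → a :* (s :* (b :* y)) := ((a :* b) :* s) :* y) refl

  rise-ι : ∀ m k → rise (ι R (suc m)) k ≈ ι R (k ! ℕ.* ((m ℕ.+ k) C k))
  rise-ι m zero    = sym (+-identityʳ 1#)
  rise-ι m (suc k) = begin
    rise (ι R (suc m)) k * (ι R (suc m) - ι R k * - 1#)
      ≈⟨ *-cong (rise-ι m k) (+-congˡ minus-times-minus-one) ⟩
    ι R (k ! ℕ.* ((m ℕ.+ k) C k)) * (ι R (suc m) + ι R k)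
      ≈⟨ *-congˡ (ι-homo-+ (suc m) k) ⟨
    ι R (k ! ℕ.* ((m ℕ.+ k) C k)) * ι R (suc (m ℕ.+ k))
      ≈⟨ ι-homo-* (k ! ℕ.* ((m ℕ.+ k) C k)) (suc (m ℕ.+ k)) ⟨
    ι R (k ! ℕ.* ((m ℕ.+ k) C k) ℕ.* suc (m ℕ.+ k))
      ≡⟨ ≡.cong (ι R) ([1+k]!*[1+m]C[1+k]≡k!*mCk*[1+m] (m ℕ.+ k) k) ⟨
    ι R (suc k ! ℕ.* (suc (m ℕ.+ k) C suc k))
      ≡⟨ ≡.cong (λ j → ι R (suc k ! ℕ.* (j C suc k))) (+-suc m k) ⟨
    ι R (suc k ! ℕ.* ((m ℕ.+ suc k) C suc k)) ∎
    where
    minus-times-minus-one : - (ι R k * - 1#) ≈ ι R k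
    minus-times-minus-one = begin
      - (ι R k * - 1#) ≈⟨ -‿cong (-‿distribʳ-* (ι R k) 1#) ⟨
      - - (ι R k * 1#) ≈⟨ -‿involutive _ ⟩
      ι R k * 1#       ≈⟨ *-identityʳ _ ⟩
      ι R k            ∎

  sumTo-degFall-ι : ∀ μ r n →
    sumTo R n (λ k → degFall R (ι R k) μ (suc r)) ≈
    sumTo R (suc r) (λ j → ((negOnePow R (suc r ∸ j) * ι R (j !)) * degStir R (- μ) (suc r) j)
                           * ι R ((n ℕ.+ j) C suc j))
  sumTo-degFall-ι μ r zero    = trans (degFall-0#-suc μ r) (sym (sumTo≈0# (suc r) (λ j _ →
    trans (*-congˡ (reflexive (≡.cong (ι R) (k>n⇒nCk≡0 (n<1+n j))))) (zeroʳ _))))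
  sumTo-degFall-ι μ r (suc n) = begin
    sumTo R n (λ k → degFall R (ι R k) μ (suc r)) + degFall R (ι R (suc n)) μ (suc r)
      ≈⟨ +-cong (sumTo-degFall-ι μ r n)
                (degFall≈Σ-signed-degStir*rise (ι R (suc n)) μ (suc r)) ⟩
    sumTo R (suc r) (T n) + sumTo R (suc r) (λ j → (N j * S j) * rise (ι R (suc n)) j)
      ≈⟨ sumTo-+ (suc r) (T n) _ ⟨
    sumTo R (suc r) (λ j → T n j + (N j * S j) * rise (ι R (suc n)) j)
      ≈⟨ sumTo-cong (suc r) (λ j _ → pascal j) ⟩
    sumTo R (suc r) (T (suc n)) ∎
    where
    N S : ℕ → Carrier
    N j = negOnePow R (suc r ∸ j)
    S   = degStir R (- μ) (suc r)
    T : ℕ → ℕ → Carrier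
    T n j = ((N j * ι R (j !)) * S j) * ι R ((n ℕ.+ j) C suc j)
    collect : ∀ a f s u v → ((a * f) * s) * u + (a * s) * (f * v) ≈ ((a * f) * s) * (v + u)
    collect = solve 5 (λ a f s u v →
      ((a :* f) :* s) :* u :+ (a :* s) :* (f :* v) := ((a :* f) :* s) :* (v :+ u)) refl
    pascal : ∀ j → T n j + (N j * S j) * rise (ι R (suc n)) j ≈ T (suc n) j
    pascal j = begin
      T n j + (N j * S j) * rise (ι R (suc n)) j
        ≈⟨ +-congˡ (*-congˡ (trans (rise-ι n j) (ι-homo-* (j !) ((n ℕ.+ j) C j)))) ⟩
      T n j + (N j * S j) * (ι R (j !) * ι R ((n ℕ.+ j) C j))
        ≈⟨ collect (N j) (ι R (j !)) (S j) _ _ ⟩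
      ((N j * ι R (j !)) * S j) * (ι R ((n ℕ.+ j) C j) + ι R ((n ℕ.+ j) C suc j))
        ≈⟨ *-congˡ (ι-homo-+ ((n ℕ.+ j) C j) ((n ℕ.+ j) C suc j)) ⟨
      ((N j * ι R (j !)) * S j) * ι R ((n ℕ.+ j) C j ℕ.+ (n ℕ.+ j) C suc j)
        ≡⟨ ≡.cong (λ m → ((N j * ι R (j !)) * S j) * ι R m)
                  (nCk+nC[k+1]≡[n+1]C[k+1] (n ℕ.+ j) j) ⟩
      T (suc n) j ∎

theorem2p16 : ∀ {c ℓ : Level} (R : CommutativeRing c ℓ) (λ′ : CommutativeRing.Carrier R) →
              ¬ (CommutativeRing._≈_ R λ′ (CommutativeRing.0# R)) →
              (r n : ℕ) → 1 ℕ.≤ r →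
              CommutativeRing._≈_ R
                (sumTo R n (λ k → degFall R (ι R k) λ′ r))
                (sumTo R r (λ j → CommutativeRing._*_ R
                   (CommutativeRing._*_ R
                     (CommutativeRing._*_ R (negOnePow R (r ∸ j)) (ι R (j ℕ.!)))
                     (degStir R (CommutativeRing.-_ R λ′) r j))
                   (ι R ((n ℕ.+ j) C (suc j)))))
theorem2p16 R λ′ _ (suc r) n (s≤s _) = sumTo-degFall-ι R λ′ r n
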